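{- Let $p$ be a prime and let $l,m\ge 1$ be integers. Then $S(p^l m)=S(pm)$ and $R(p^l m)=R(pm)$.
   Context: For $n\ge 1$, $\Phi_n(x)=\sum_{k=0}^{\varphi(n)} a(n,k)x^k$ denotes the $n$th cyclotomic polynomial, with $a(n,k)=0$ for $k>\varphi(n)$, and $c(n,k)$ are defined by $\frac{1}{\Phi_n(x)}=\sum_{k=0}^{\infty} c(n,k)x^k$ (Taylor expansion at $x=0$). For an integer $m\ge1$, $S(m)=\{ a(mn,k) \mid n\ge 1,\ k\ge 0\}$ and $R(m)=\{ c(mn,k) \mid n\ge 1,\ k\ge 0\}$. -}

module Defs where

open import Data.Nat as ℕ using (ℕ; zero; suc; _∸_; _≥_)
open import Data.Nat.Divisibility using (_∣?_)
open import Data.Integer as ℤ using (ℤ; +_; -_; _*_; _+_; _-_)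
open import Data.Fin using (Fin; toℕ)
open import Data.Vec as Vec using (Vec; []; _∷_; _∷ʳ_; lookup; tabulate; last; allFin)
open import Data.Product using (∃; ∃-syntax; _×_)
open import Relation.Nullary using (does)
open import Relation.Binary.PropositionalEquality using (_≡_)
open import Data.Bool using (if_then_else_)

-- Formal power series with integer coefficients (coefficient of x^k at k).
Series : Set
Series = ℕ → ℤ

sumTo : (ℕ → ℤ) → ℕ → ℤ
sumTo f zero    = + 0
sumTo f (suc n) = sumTo f n + f n

mulS : Series → Series → Series
mulS f g k = sumTo (λ i → f i * g (k ∸ i)) (suc k)

oneS : Series
oneS zero    = + 1
oneS (suc _) = + 0

-- x^m - 1
xpowMinus1 : ℕ → Series
xpowMinus1 m k = if does (k ℕ.≟ m) then + 1 ℤ.+ negzero k else negzero k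
  where
  negzero : ℕ → ℤ
  negzero zero    = - (+ 1)
  negzero (suc _) = + 0

-- Multiplicative inverse of a power series whose constant term f 0 is ±1
-- (so f 0 is its own inverse):  c₀ = f 0,  c_K = - f 0 * Σ_{i=1}^{K} f i * c_{K-i}.
invVec : Series → (k : ℕ) → Vec ℤ (suc k)
invVec f zero    = f 0 ∷ []
invVec f (suc k) = v ∷ʳ (- (f 0 * Vec.foldr _ _+_ (+ 0) (tabulate (λ (j : Fin (suc k)) → f (suc k ∸ toℕ j) * lookup v j))))
  where v = invVec f k

invS : Series → Series
invS f k = last (invVec f k)

-- ΦVec n = [Φ₁, …, Φₙ], with Φ_m = (x^m - 1) / ∏_{d ∣ m, d < m} Φ_d
-- (exact division by a polynomial with constant term ±1, computed as power series).
ΦVec : (n : ℕ) → Vec Series n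
ΦVec zero    = []
ΦVec (suc n) = prev ∷ʳ mulS (xpowMinus1 (suc n)) (invS P)
  where
  prev = ΦVec n
  P : Series
  P = Vec.foldr _ (λ j acc → if does (suc (toℕ j) ∣? suc n) then mulS (lookup prev j) acc else acc)
                 oneS (allFin n)

-- n-th cyclotomic polynomial as coefficient sequence (Φ 0 is a dummy, never used).
Φ : ℕ → Series
Φ zero    = oneS
Φ (suc n) = last (ΦVec (suc n))

a : ℕ → ℕ → ℤ
a n k = Φ n k

c : ℕ → ℕ → ℤ
c n k = invS (Φ n) k

S : ℕ → ℤ → Set
S m z = ∃[ n ] ∃[ k ] (n ≥ 1 × a (m ℕ.* n) k ≡ z)

R : ℕ → ℤ → Set
R m z = ∃[ n ] ∃[ k ] (n ≥ 1 × c (m ℕ.* n) k ≡ z)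

{-# OPTIONS --safe #-}
module Submission where

-- The key fact is that Φ_{pN}(x) = Φ_N(x^p) whenever p ∣ N, proved by strong induction on N.
-- The divisors of pN are those of N together with the pe where e ∣ N but pe ∤ N; such an e is
-- divisible by p unless e = N, so by induction the corresponding Φ_{pe} multiply to W(x^p),
-- where W = ∏ Φ_e over those e ≠ N. Hence x^{pN} − 1 = (x^N − 1) Φ_{pN}(x) W(x^p), while
-- substituting x^p into x^N − 1 = (x^M − 1) Φ_N(x) W(x) (where N = pM) gives
-- x^{pN} − 1 = (x^N − 1) Φ_N(x^p) W(x^p); all factors have constant term ±1 and cancel.
-- Iterating, the coefficient of x^{p^{l-1}k} in Φ_{p^l mn} (resp. 1/Φ_{p^l mn}) is that of x^k in
-- Φ_{pmn} (resp. 1/Φ_{pmn}); the other inclusions are trivial since p^l mn = pm · p^{l-1}n.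

open import Defs
open import Data.Nat as ℕ using (ℕ; zero; suc; _∸_; _<_; _≤_; s≤s; z≤n)
import Data.Nat.Properties as ℕP
open import Data.Nat.Primality using (Prime; prime⇒nonTrivial)
open import Data.Integer using (ℤ; +_; -_)
import Data.Integer.Properties as ℤP
open import Data.Bool using (Bool; true; false; if_then_else_; _∧_; not)
open import Data.Empty using (⊥-elim)
open import Data.Fin as Fin using (Fin; toℕ; fromℕ<)
import Data.Fin.Properties as FinP
open import Data.Vec as Vec using (Vec; []; _∷_; _∷ʳ_; lookup; tabulate)
import Data.Vec.Properties as VecP
open import Data.Product using (_×_; _,_; proj₂)
open import Function using (_∘_)
open import Relation.Binary.PropositionalEquality
open import Relation.Binary.Bundles using (Setoid)
open import Relation.Nullary using (Dec; does; yes; no; ¬_; _because_; ofʸ)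

lookup-∷ʳ-< : ∀ {A : Set} {n} (xs : Vec A n) x (j : Fin (suc n)) (j<n : toℕ j < n) →
              lookup (xs ∷ʳ x) j ≡ lookup xs (fromℕ< j<n)
lookup-∷ʳ-< (y ∷ xs) x Fin.zero    j<n       = refl
lookup-∷ʳ-< (y ∷ xs) x (Fin.suc j) (s≤s j<n) = lookup-∷ʳ-< xs x j j<n

lookup-∷ʳ-last : ∀ {A : Set} {n} (xs : Vec A n) x (j : Fin (suc n)) → toℕ j ≡ n → lookup (xs ∷ʳ x) j ≡ x
lookup-∷ʳ-last []       x Fin.zero    _ = refl
lookup-∷ʳ-last (y ∷ xs) x (Fin.suc j) e = lookup-∷ʳ-last xs x j (ℕP.suc-injective e)

toℕ≮⇒≡ : ∀ {n} (j : Fin (suc n)) → ¬ toℕ j < n → toℕ j ≡ n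
toℕ≮⇒≡ j j≮n = ℕP.≤-antisym (ℕP.≤-pred (FinP.toℕ<n j)) (ℕP.≮⇒≥ j≮n)

does≡true⇒ : ∀ {P : Set} (P? : Dec P) → does P? ≡ true → P
does≡true⇒ (true because ofʸ x) _ = x

module PowerSeries where
  open import Data.Integer using (_+_; _*_)
  open import Data.Integer.Tactic.RingSolver using (solve-∀)

  infix 4 _≈_
  _≈_ : Series → Series → Set
  f ≈ g = ∀ k → f k ≡ g k

  ≈-setoid : Setoid _ _
  ≈-setoid = record
    { Carrier       = Series
    ; _≈_           = _≈_
    ; isEquivalence = record
      { refl  = λ _ → refl
      ; sym   = λ e k → sym (e k)
      ; trans = λ e e′ k → trans (e k) (e′ k)
      }
    }

  open Setoid ≈-setoid public using () renaming (refl to ≈-refl; sym to ≈-sym; trans to ≈-trans)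

  ≡⇒≈ : ∀ {f g} → f ≡ g → f ≈ g
  ≡⇒≈ refl = ≈-refl

  infixr 8 _·_
  infixl 7 _∙_
  infixl 6 _⊕_

  _∙_ : Series → Series → Series
  _∙_ = mulS

  _⊕_ : Series → Series → Series
  (f ⊕ g) k = f k + g k

  _·_ : ℤ → Series → Series
  (c · f) k = c * f k

  shift : Series → Series
  shift f k = f (suc k)

  sumTo-unfoldˡ : ∀ f n → sumTo f (suc n) ≡ f 0 + sumTo (f ∘ suc) n
  sumTo-unfoldˡ f zero    = trans (ℤP.+-identityˡ (f 0)) (sym (ℤP.+-identityʳ (f 0)))
  sumTo-unfoldˡ f (suc n) = trans (cong (_+ f (suc n)) (sumTo-unfoldˡ f n)) (ℤP.+-assoc (f 0) _ _)

  ∙-head : ∀ f g → (f ∙ g) 0 ≡ f 0 * g 0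
  ∙-head f g = ℤP.+-identityˡ _

  ∙-suc : ∀ f g k → (f ∙ g) (suc k) ≡ f 0 * g (suc k) + (shift f ∙ g) k
  ∙-suc f g k = sumTo-unfoldˡ (λ i → f i * g (suc k ∸ i)) (suc k)

  shift-∙ : ∀ f g → shift (f ∙ g) ≈ f 0 · shift g ⊕ shift f ∙ g
  shift-∙ = ∙-suc

  ∙-cong : ∀ {f f′ g g′} → f ≈ f′ → g ≈ g′ → f ∙ g ≈ f′ ∙ g′
  ∙-cong {f} {f′} {g} {g′} ef eg zero = begin
    (f ∙ g) 0      ≡⟨ ∙-head f g ⟩
    f 0 * g 0      ≡⟨ cong₂ _*_ (ef 0) (eg 0) ⟩
    f′ 0 * g′ 0    ≡⟨ ∙-head f′ g′ ⟨
    (f′ ∙ g′) 0    ∎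
    where open ≡-Reasoning
  ∙-cong {f} {f′} {g} {g′} ef eg (suc k) = begin
    (f ∙ g) (suc k)                           ≡⟨ ∙-suc f g k ⟩
    f 0 * g (suc k) + (shift f ∙ g) k         ≡⟨ cong₂ _+_ (cong₂ _*_ (ef 0) (eg (suc k)))
                                                   (∙-cong {shift f} {shift f′} (ef ∘ suc) eg k) ⟩
    f′ 0 * g′ (suc k) + (shift f′ ∙ g′) k     ≡⟨ ∙-suc f′ g′ k ⟨
    (f′ ∙ g′) (suc k)                         ∎
    where open ≡-Reasoning

  ∙-congˡ : ∀ {f f′} g → f ≈ f′ → f ∙ g ≈ f′ ∙ g
  ∙-congˡ {f} {f′} g e = ∙-cong {f} {f′} {g} {g} e (λ _ → refl)

  ∙-congʳ : ∀ f {g g′} → g ≈ g′ → f ∙ g ≈ f ∙ g′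
  ∙-congʳ f {g} {g′} e = ∙-cong {f} {f} {g} {g′} (λ _ → refl) e

  ∙-distribʳ-⊕ : ∀ f g h → (f ⊕ g) ∙ h ≈ f ∙ h ⊕ g ∙ h
  ∙-distribʳ-⊕ f g h zero =
    trans (∙-head (f ⊕ g) h) (trans (ℤP.*-distribʳ-+ (h 0) (f 0) (g 0)) (sym (cong₂ _+_ (∙-head f h) (∙-head g h))))
  ∙-distribʳ-⊕ f g h (suc k) = begin
    ((f ⊕ g) ∙ h) (suc k)                                     ≡⟨ ∙-suc (f ⊕ g) h k ⟩
    (f 0 + g 0) * h (suc k) + ((shift f ⊕ shift g) ∙ h) k     ≡⟨ cong (_+_ ((f 0 + g 0) * h (suc k)))
                                                                   (∙-distribʳ-⊕ (shift f) (shift g) h k) ⟩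
    (f 0 + g 0) * h (suc k) + ((shift f ∙ h) k + (shift g ∙ h) k)
      ≡⟨ interchange (f 0) (g 0) (h (suc k)) _ _ ⟩
    (f 0 * h (suc k) + (shift f ∙ h) k) + (g 0 * h (suc k) + (shift g ∙ h) k)
      ≡⟨ cong₂ _+_ (∙-suc f h k) (∙-suc g h k) ⟨
    (f ∙ h ⊕ g ∙ h) (suc k)                                   ∎
    where
    open ≡-Reasoning
    interchange : ∀ a b c x y → (a + b) * c + (x + y) ≡ (a * c + x) + (b * c + y)
    interchange = solve-∀

  ∙-scaleˡ : ∀ c f h → (c · f) ∙ h ≈ c · (f ∙ h)
  ∙-scaleˡ c f h zero = trans (∙-head (c · f) h) (trans (ℤP.*-assoc c (f 0) (h 0)) (cong (c *_) (sym (∙-head f h))))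
  ∙-scaleˡ c f h (suc k) = begin
    ((c · f) ∙ h) (suc k)                          ≡⟨ ∙-suc (c · f) h k ⟩
    c * f 0 * h (suc k) + ((c · shift f) ∙ h) k    ≡⟨ cong (_+_ (c * f 0 * h (suc k))) (∙-scaleˡ c (shift f) h k) ⟩
    c * f 0 * h (suc k) + c * (shift f ∙ h) k      ≡⟨ factor c (f 0) (h (suc k)) _ ⟩
    c * (f 0 * h (suc k) + (shift f ∙ h) k)        ≡⟨ cong (c *_) (∙-suc f h k) ⟨
    (c · (f ∙ h)) (suc k)                          ∎
    where
    open ≡-Reasoning
    factor : ∀ c a b x → c * a * b + c * x ≡ c * (a * b + x)
    factor = solve-∀

  ∙-assoc : ∀ f g h → (f ∙ g) ∙ h ≈ f ∙ (g ∙ h)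
  ∙-assoc f g h zero = begin
    ((f ∙ g) ∙ h) 0       ≡⟨ ∙-head (f ∙ g) h ⟩
    (f ∙ g) 0 * h 0       ≡⟨ cong (_* h 0) (∙-head f g) ⟩
    f 0 * g 0 * h 0       ≡⟨ ℤP.*-assoc (f 0) (g 0) (h 0) ⟩
    f 0 * (g 0 * h 0)     ≡⟨ cong (f 0 *_) (∙-head g h) ⟨
    f 0 * (g ∙ h) 0       ≡⟨ ∙-head f (g ∙ h) ⟨
    (f ∙ (g ∙ h)) 0       ∎
    where open ≡-Reasoning
  ∙-assoc f g h (suc k) = begin
    ((f ∙ g) ∙ h) (suc k)
      ≡⟨ ∙-suc (f ∙ g) h k ⟩
    (f ∙ g) 0 * h (suc k) + (shift (f ∙ g) ∙ h) k
      ≡⟨ cong₂ _+_ (cong (_* h (suc k)) (∙-head f g)) (∙-congˡ h (shift-∙ f g) k) ⟩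
    f 0 * g 0 * h (suc k) + ((f 0 · shift g ⊕ shift f ∙ g) ∙ h) k
      ≡⟨ cong (_+_ (f 0 * g 0 * h (suc k))) (trans (∙-distribʳ-⊕ (f 0 · shift g) (shift f ∙ g) h k)
           (cong₂ _+_ (∙-scaleˡ (f 0) (shift g) h k) (∙-assoc (shift f) g h k))) ⟩
    f 0 * g 0 * h (suc k) + (f 0 * (shift g ∙ h) k + (shift f ∙ (g ∙ h)) k)
      ≡⟨ regroup (f 0) (g 0) (h (suc k)) _ _ ⟩
    f 0 * (g 0 * h (suc k) + (shift g ∙ h) k) + (shift f ∙ (g ∙ h)) k
      ≡⟨ cong (λ t → f 0 * t + (shift f ∙ (g ∙ h)) k) (∙-suc g h k) ⟨
    f 0 * (g ∙ h) (suc k) + (shift f ∙ (g ∙ h)) k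
      ≡⟨ ∙-suc f (g ∙ h) k ⟨
    (f ∙ (g ∙ h)) (suc k)
      ∎
    where
    open ≡-Reasoning
    regroup : ∀ a b c x y → a * b * c + (a * x + y) ≡ a * (b * c + x) + y
    regroup = solve-∀

  ∙-comm : ∀ f g → f ∙ g ≈ g ∙ f
  ∙-comm f g zero = trans (∙-head f g) (trans (ℤP.*-comm (f 0) (g 0)) (sym (∙-head g f)))
  ∙-comm f g (suc zero) = begin
    (f ∙ g) 1                        ≡⟨ ∙-suc f g 0 ⟩
    f 0 * g 1 + (shift f ∙ g) 0      ≡⟨ cong (_+_ (f 0 * g 1)) (∙-head (shift f) g) ⟩
    f 0 * g 1 + f 1 * g 0            ≡⟨ swap (f 0) (g 1) (f 1) (g 0) ⟩
    g 0 * f 1 + g 1 * f 0            ≡⟨ cong (_+_ (g 0 * f 1)) (∙-head (shift g) f) ⟨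
    g 0 * f 1 + (shift g ∙ f) 0      ≡⟨ ∙-suc g f 0 ⟨
    (g ∙ f) 1                        ∎
    where
    open ≡-Reasoning
    swap : ∀ a b c d → a * b + c * d ≡ d * c + b * a
    swap = solve-∀
  ∙-comm f g (suc (suc k)) = begin
    (f ∙ g) (2 ℕ.+ k)
      ≡⟨ ∙-suc f g (suc k) ⟩
    f 0 * g (2 ℕ.+ k) + (shift f ∙ g) (suc k)
      ≡⟨ cong (_+_ (f 0 * g (2 ℕ.+ k))) (trans (∙-comm (shift f) g (suc k)) (∙-suc g (shift f) k)) ⟩
    f 0 * g (2 ℕ.+ k) + (g 0 * f (2 ℕ.+ k) + (shift g ∙ shift f) k)
      ≡⟨ cong (λ t → f 0 * g (2 ℕ.+ k) + (g 0 * f (2 ℕ.+ k) + t)) (∙-comm (shift g) (shift f) k) ⟩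
    f 0 * g (2 ℕ.+ k) + (g 0 * f (2 ℕ.+ k) + (shift f ∙ shift g) k)
      ≡⟨ exchange (f 0 * g (2 ℕ.+ k)) (g 0 * f (2 ℕ.+ k)) _ ⟩
    g 0 * f (2 ℕ.+ k) + (f 0 * g (2 ℕ.+ k) + (shift f ∙ shift g) k)
      ≡⟨ cong (_+_ (g 0 * f (2 ℕ.+ k))) (trans (∙-comm (shift g) f (suc k)) (∙-suc f (shift g) k)) ⟨
    g 0 * f (2 ℕ.+ k) + (shift g ∙ f) (suc k)
      ≡⟨ ∙-suc g f (suc k) ⟨
    (g ∙ f) (2 ℕ.+ k)
      ∎
    where
    open ≡-Reasoning
    exchange : ∀ a b c → a + (b + c) ≡ b + (a + c)
    exchange = solve-∀

  ∙-zeroˡ-upTo : ∀ f g k → (∀ i → i ≤ k → f i ≡ + 0) → (f ∙ g) k ≡ + 0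
  ∙-zeroˡ-upTo f g zero    z = trans (∙-head f g) (cong (_* g 0) (z 0 z≤n))
  ∙-zeroˡ-upTo f g (suc k) z = trans (∙-suc f g k)
    (cong₂ _+_ (cong (_* g (suc k)) (z 0 z≤n)) (∙-zeroˡ-upTo (shift f) g k (λ i i≤k → z (suc i) (s≤s i≤k))))

  ∙-identityˡ : ∀ f → oneS ∙ f ≈ f
  ∙-identityˡ f zero    = trans (∙-head oneS f) (ℤP.*-identityˡ (f 0))
  ∙-identityˡ f (suc k) = trans (∙-suc oneS f k)
    (trans (cong₂ _+_ (ℤP.*-identityˡ (f (suc k))) (∙-zeroˡ-upTo (shift oneS) f k (λ _ _ → refl))) (ℤP.+-identityʳ _))

  ∙-identityʳ : ∀ f → f ∙ oneS ≈ f
  ∙-identityʳ f = ≈-trans (∙-comm f oneS) (∙-identityˡ f)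

  ∙-lcomm : ∀ f g h → f ∙ (g ∙ h) ≈ g ∙ (f ∙ h)
  ∙-lcomm f g h = ≈-trans (≈-sym (∙-assoc f g h)) (≈-trans (∙-congˡ h (∙-comm f g)) (∙-assoc g f h))

module Inverse where
  open PowerSeries
  open import Data.Integer using (_+_; _*_; _-_)
  open import Data.Integer.Tactic.RingSolver using (solve-∀)

  -- Over ℤ this says f 0 = ±1, exactly the case in which invS f inverts f.
  IsUnit : Series → Set
  IsUnit f = f 0 * f 0 ≡ + 1

  IsUnit-≈ : ∀ {f g} → f ≈ g → IsUnit f → IsUnit g
  IsUnit-≈ e u = trans (cong₂ _*_ (sym (e 0)) (sym (e 0))) u

  IsUnit-∙ : ∀ f g → IsUnit f → IsUnit g → IsUnit (f ∙ g)
  IsUnit-∙ f g uf ug = begin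
    (f ∙ g) 0 * (f ∙ g) 0      ≡⟨ cong₂ _*_ (∙-head f g) (∙-head f g) ⟩
    f 0 * g 0 * (f 0 * g 0)    ≡⟨ rearrange (f 0) (g 0) ⟩
    f 0 * f 0 * (g 0 * g 0)    ≡⟨ cong₂ _*_ uf ug ⟩
    + 1                        ∎
    where
    open ≡-Reasoning
    rearrange : ∀ a b → a * b * (a * b) ≡ a * a * (b * b)
    rearrange = solve-∀

  sumTo-cong : ∀ {f g} → (∀ i → f i ≡ g i) → ∀ n → sumTo f n ≡ sumTo g n
  sumTo-cong e zero    = refl
  sumTo-cong e (suc n) = cong₂ _+_ (sumTo-cong e n) (e n)

  foldr-+-tabulate : ∀ n (g : ℕ → ℤ) → Vec.foldr _ _+_ (+ 0) (tabulate {n = n} (g ∘ toℕ)) ≡ sumTo g n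
  foldr-+-tabulate zero    g = refl
  foldr-+-tabulate (suc n) g = trans (cong (_+_ (g 0)) (foldr-+-tabulate n (g ∘ suc))) (sym (sumTo-unfoldˡ g n))

  lookup-invVec : ∀ f k (j : Fin (suc k)) → lookup (invVec f k) j ≡ invS f (toℕ j)
  lookup-invVec f zero    Fin.zero = refl
  lookup-invVec f (suc k) j with toℕ j ℕP.<? suc k
  ... | yes j<k = trans (lookup-∷ʳ-< (invVec f k) _ j j<k)
                    (trans (lookup-invVec f k (fromℕ< j<k)) (cong (invS f) (FinP.toℕ-fromℕ< j<k)))
  ... | no  j≮k = trans (lookup-∷ʳ-last (invVec f k) _ j (toℕ≮⇒≡ j j≮k))
                    (sym (trans (cong (invS f) (toℕ≮⇒≡ j j≮k)) (VecP.last-∷ʳ _ (invVec f k))))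

  invS-suc : ∀ f k → invS f (suc k) ≡ - (f 0 * sumTo (λ j → f (suc k ∸ j) * invS f j) (suc k))
  invS-suc f k = trans (VecP.last-∷ʳ _ (invVec f k)) (cong (λ t → - (f 0 * t))
    (trans (cong (Vec.foldr _ _+_ (+ 0)) (VecP.tabulate-cong (λ j → cong (f (suc k ∸ toℕ j) *_) (lookup-invVec f k j))))
           (foldr-+-tabulate (suc k) (λ j → f (suc k ∸ j) * invS f j))))

  invS-inverseˡ : ∀ f → IsUnit f → invS f ∙ f ≈ oneS
  invS-inverseˡ f u zero    = trans (∙-head (invS f) f) u
  invS-inverseˡ f u (suc k) = begin
    (invS f ∙ f) (suc k)
      ≡⟨ cong (λ t → sumTo (λ i → invS f i * f (suc k ∸ i)) (suc k) + invS f (suc k) * f t) (ℕP.n∸n≡0 k) ⟩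
    sumTo (λ i → invS f i * f (suc k ∸ i)) (suc k) + invS f (suc k) * f 0
      ≡⟨ cong₂ (λ s t → s + t * f 0) (sumTo-cong (λ i → ℤP.*-comm (invS f i) (f (suc k ∸ i))) (suc k)) (invS-suc f k) ⟩
    T + - (f 0 * T) * f 0
      ≡⟨ rearrange (f 0) T ⟩
    T - f 0 * f 0 * T
      ≡⟨ cong (λ t → T - t * T) u ⟩
    T - + 1 * T
      ≡⟨ cancel T ⟩
    + 0
      ∎
    where
    open ≡-Reasoning
    T = sumTo (λ j → f (suc k ∸ j) * invS f j) (suc k)
    rearrange : ∀ a t → t + - (a * t) * a ≡ t - a * a * t
    rearrange = solve-∀
    cancel : ∀ t → t - + 1 * t ≡ + 0
    cancel = solve-∀

  invS-inverseʳ : ∀ f → IsUnit f → f ∙ invS f ≈ oneS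
  invS-inverseʳ f u = ≈-trans (∙-comm f (invS f)) (invS-inverseˡ f u)

  ∙-cancelʳ : ∀ f g h → IsUnit g → f ∙ g ≈ h ∙ g → f ≈ h
  ∙-cancelʳ f g h u e = begin
    f                       ≈⟨ ∙-identityʳ f ⟨
    f ∙ oneS                ≈⟨ ∙-congʳ f (invS-inverseʳ g u) ⟨
    f ∙ (g ∙ invS g)        ≈⟨ ∙-assoc f g (invS g) ⟨
    f ∙ g ∙ invS g          ≈⟨ ∙-congˡ (invS g) e ⟩
    h ∙ g ∙ invS g          ≈⟨ ∙-assoc h g (invS g) ⟩
    h ∙ (g ∙ invS g)        ≈⟨ ∙-congʳ h (invS-inverseʳ g u) ⟩
    h ∙ oneS                ≈⟨ ∙-identityʳ h ⟩
    h                       ∎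
    where open import Relation.Binary.Reasoning.Setoid ≈-setoid

  ∙-cancelˡ : ∀ f g h → IsUnit f → f ∙ g ≈ f ∙ h → g ≈ h
  ∙-cancelˡ f g h u e = ∙-cancelʳ g f h u (≈-trans (∙-comm g f) (≈-trans e (∙-comm f h)))

  invS-unique : ∀ f g → IsUnit f → g ∙ f ≈ oneS → g ≈ invS f
  invS-unique f g u e = ∙-cancelʳ g f (invS f) u (≈-trans e (≈-sym (invS-inverseˡ f u)))

  invS-cong : ∀ {f g} → IsUnit g → f ≈ g → invS f ≈ invS g
  invS-cong {f} {g} u e = invS-unique g (invS f) u
    (≈-trans (∙-congʳ (invS f) (≈-sym e)) (invS-inverseˡ f (IsUnit-≈ (≈-sym e) u)))

module Products where
  open PowerSeries
  open Inverse

  mulWhen : Bool → Series → Series → Series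
  mulWhen b f g = if b then f ∙ g else g

  prodWhen : (ℕ → Bool) → (ℕ → Series) → ℕ → Series
  prodWhen B F zero    = oneS
  prodWhen B F (suc n) = mulWhen (B n) (F n) (prodWhen B F n)

  prodFrom : (ℕ → Bool) → (ℕ → Series) → ℕ → ℕ → Series
  prodFrom B F s zero    = oneS
  prodFrom B F s (suc n) = mulWhen (B s) (F s) (prodFrom B F (suc s) n)

  mulWhen-congʳ : ∀ b f {g g′} → g ≈ g′ → mulWhen b f g ≈ mulWhen b f g′
  mulWhen-congʳ true  f e = ∙-congʳ f e
  mulWhen-congʳ false f e = e

  mulWhen-swap : ∀ b c f g h → mulWhen b f (mulWhen c g h) ≈ mulWhen c g (mulWhen b f h)
  mulWhen-swap true  true  f g h = ∙-lcomm f g h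
  mulWhen-swap true  false f g h = ≈-refl
  mulWhen-swap false true  f g h = ≈-refl
  mulWhen-swap false false f g h = ≈-refl

  prodFrom-suc : ∀ B F s n → prodFrom B F s (suc n) ≈ mulWhen (B (s ℕ.+ n)) (F (s ℕ.+ n)) (prodFrom B F s n)
  prodFrom-suc B F s zero rewrite ℕP.+-identityʳ s = ≈-refl
  prodFrom-suc B F s (suc n) rewrite ℕP.+-suc s n =
    ≈-trans (mulWhen-congʳ (B s) (F s) (prodFrom-suc B F (suc s) n))
            (mulWhen-swap (B s) (B (suc s ℕ.+ n)) (F s) (F (suc s ℕ.+ n)) _)

  prodFrom≈prodWhen : ∀ B F n → prodFrom B F 0 n ≈ prodWhen B F n
  prodFrom≈prodWhen B F zero    = ≈-refl
  prodFrom≈prodWhen B F (suc n) = ≈-trans (prodFrom-suc B F 0 n) (mulWhen-congʳ (B n) (F n) (prodFrom≈prodWhen B F n))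

  foldr-tabulate≈prodFrom : ∀ {m} n s (g : Fin n → Fin m) (step : Fin m → Series → Series) B F →
    (∀ j acc → step j acc ≡ mulWhen (B (toℕ j)) (F (toℕ j)) acc) → (∀ j → toℕ (g j) ≡ s ℕ.+ toℕ j) →
    Vec.foldr _ step oneS (tabulate g) ≈ prodFrom B F s n
  foldr-tabulate≈prodFrom zero    s g step B F _      _    = ≈-refl
  foldr-tabulate≈prodFrom (suc n) s g step B F step≡ g≡
    rewrite step≡ (g Fin.zero) (Vec.foldr _ step oneS (tabulate (g ∘ Fin.suc)))
          | trans (g≡ Fin.zero) (ℕP.+-identityʳ s) =
    mulWhen-congʳ (B s) (F s)
      (foldr-tabulate≈prodFrom n (suc s) (g ∘ Fin.suc) step B F step≡ (λ j → trans (g≡ (Fin.suc j)) (ℕP.+-suc s (toℕ j))))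

  module _ (B C : ℕ → Bool) (F : ℕ → Series) where
    private
      prodYes prodNo : ℕ → Series
      prodYes = prodWhen (λ j → B j ∧ C j) F
      prodNo  = prodWhen (λ j → B j ∧ not (C j)) F

    prodWhen-split : ∀ n → prodWhen B F n ≈ prodYes n ∙ prodNo n
    prodWhen-split zero = ≈-sym (∙-identityˡ oneS)
    prodWhen-split (suc n) with B n | C n
    ... | true  | true  = ≈-trans (∙-congʳ (F n) (prodWhen-split n)) (≈-sym (∙-assoc (F n) (prodYes n) (prodNo n)))
    ... | true  | false = ≈-trans (∙-congʳ (F n) (prodWhen-split n)) (∙-lcomm (F n) (prodYes n) (prodNo n))
    ... | false | _     = prodWhen-split n

  prodWhen-cong : ∀ {B B′} F n → (∀ j → j < n → B j ≡ B′ j) → prodWhen B F n ≡ prodWhen B′ F n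
  prodWhen-cong F zero    e = refl
  prodWhen-cong F (suc n) e = cong₂ (λ b g → mulWhen b (F n) g) (e n ℕP.≤-refl) (prodWhen-cong F n (λ j j<n → e j (ℕP.m≤n⇒m≤1+n j<n)))

  prodWhen-congF : ∀ B {F F′} n → (∀ j → j < n → B j ≡ true → F j ≈ F′ j) → prodWhen B F n ≈ prodWhen B F′ n
  prodWhen-congF B zero    e = ≈-refl
  prodWhen-congF B (suc n) e with B n in Bn
  ... | true  = ∙-cong (e n ℕP.≤-refl Bn) (prodWhen-congF B n (λ j j<n → e j (ℕP.m≤n⇒m≤1+n j<n)))
  ... | false = prodWhen-congF B n (λ j j<n → e j (ℕP.m≤n⇒m≤1+n j<n))

  prodWhen-+ : ∀ B F n → (∀ i → n ≤ i → B i ≡ false) → ∀ k → prodWhen B F (k ℕ.+ n) ≡ prodWhen B F n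
  prodWhen-+ B F n none zero = refl
  prodWhen-+ B F n none (suc k) rewrite none (k ℕ.+ n) (ℕP.m≤n+m n k) = prodWhen-+ B F n none k

  prodWhen-suc-true : ∀ B F n → B n ≡ true → prodWhen B F (suc n) ≡ F n ∙ prodWhen B F n
  prodWhen-suc-true B F n Bn rewrite Bn = refl

  IsUnit-prodWhen : ∀ B F n → (∀ i → i < n → IsUnit (F i)) → IsUnit (prodWhen B F n)
  IsUnit-prodWhen B F zero    u = refl
  IsUnit-prodWhen B F (suc n) u with B n
  ... | true  = IsUnit-∙ (F n) (prodWhen B F n) (u n ℕP.≤-refl) (IsUnit-prodWhen B F n (λ i i<n → u i (ℕP.m≤n⇒m≤1+n i<n)))
  ... | false = IsUnit-prodWhen B F n (λ i i<n → u i (ℕP.m≤n⇒m≤1+n i<n))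

  prodWhen-gap : ∀ B F m i q → i ≤ q → (∀ i′ → i′ < q → B (m ℕ.+ i′) ≡ false) → prodWhen B F (m ℕ.+ i) ≡ prodWhen B F m
  prodWhen-gap B F m zero    q _   none rewrite ℕP.+-identityʳ m = refl
  prodWhen-gap B F m (suc i) q i<q none rewrite ℕP.+-suc m i | none i i<q = prodWhen-gap B F m i q (ℕP.<⇒≤ i<q) none

  prodWhen-sparse : ∀ q B F n → (∀ e i → i < q → B (e ℕ.* suc q ℕ.+ i) ≡ false) →
    prodWhen B F (n ℕ.* suc q) ≡ prodWhen (λ e → B (e ℕ.* suc q ℕ.+ q)) (λ e → F (e ℕ.* suc q ℕ.+ q)) n
  prodWhen-sparse q B F zero    none = refl
  prodWhen-sparse q B F (suc n) none = begin
    prodWhen B F (suc n ℕ.* suc q)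
      ≡⟨ cong (prodWhen B F) (trans (ℕP.+-comm (suc q) (n ℕ.* suc q)) (ℕP.+-suc (n ℕ.* suc q) q)) ⟩
    mulWhen (B (n ℕ.* suc q ℕ.+ q)) (F (n ℕ.* suc q ℕ.+ q)) (prodWhen B F (n ℕ.* suc q ℕ.+ q))
      ≡⟨ cong (mulWhen (B (n ℕ.* suc q ℕ.+ q)) (F (n ℕ.* suc q ℕ.+ q)))
              (trans (prodWhen-gap B F (n ℕ.* suc q) q q ℕP.≤-refl (none n)) (prodWhen-sparse q B F n none)) ⟩
    prodWhen (λ e → B (e ℕ.* suc q ℕ.+ q)) (λ e → F (e ℕ.* suc q ℕ.+ q)) (suc n)
      ∎
    where open ≡-Reasoning

module Dilation (q : ℕ) where
  open PowerSeries
  open Inverse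
  open Products
  open import Data.Integer using (_+_; _*_)
  open import Data.Nat.DivMod using (_%_; _/_; m/n≡1+[m∸n]/n; [m+n]%n≡m%n; m*n%n≡0; m*n/n≡m; m<n⇒m%n≡m; m≡m%n+[m/n]*n; m*[n/m]≡n)
  open import Data.Nat.Divisibility using (m%n≡0⇒n∣m)
  open import Function.Bundles using (mk⇔)
  open import Relation.Nullary.Decidable using (does-⇔; dec-true)

  p : ℕ
  p = suc q

  -- dilate F is F (x ^ p).
  dilate : Series → Series
  dilate F k = if does (k % p ℕ.≟ 0) then F (k / p) else + 0

  dilate-p+ : ∀ F j → dilate F (p ℕ.+ j) ≡ dilate (shift F) j
  dilate-p+ F j
    rewrite trans (cong (_% p) (ℕP.+-comm p j)) ([m+n]%n≡m%n j p)
          | trans (m/n≡1+[m∸n]/n {p ℕ.+ j} {p} (ℕP.m≤m+n p j)) (cong (λ t → suc (t / p)) (ℕP.m+n∸m≡n p j)) = refl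

  dilate-p* : ∀ F k → dilate F (p ℕ.* k) ≡ F k
  dilate-p* F k
    rewrite trans (cong (_% p) (ℕP.*-comm p k)) (m*n%n≡0 k p)
          | trans (cong (_/ p) (ℕP.*-comm p k)) (m*n/n≡m k p) = refl

  dilate-suc-< : ∀ F i → i < q → dilate F (suc i) ≡ + 0
  dilate-suc-< F i i<q rewrite m<n⇒m%n≡m {m = suc i} (s≤s i<q) = refl

  dilate-cong : ∀ {F G} → F ≈ G → dilate F ≈ dilate G
  dilate-cong e k with does (k % p ℕ.≟ 0)
  ... | true  = e (k / p)
  ... | false = refl

  dilate-⊕ : ∀ F G → dilate (F ⊕ G) ≈ dilate F ⊕ dilate G
  dilate-⊕ F G k with does (k % p ℕ.≟ 0)
  ... | true  = refl
  ... | false = refl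

  dilate-· : ∀ c F → dilate (c · F) ≈ c · dilate F
  dilate-· c F k with does (k % p ℕ.≟ 0)
  ... | true  = refl
  ... | false = sym (ℤP.*-zeroʳ c)

  dilate-oneS : dilate oneS ≈ oneS
  dilate-oneS zero = refl
  dilate-oneS (suc k) with does (suc k % p ℕ.≟ 0) in p∣k+1
  ... | false = refl
  ... | true with suc k / p in quotient
  ...   | suc _ = refl
  ...   | zero  = ⊥-elim (ℕP.1+n≢0 (begin
    suc k                       ≡⟨ m≡m%n+[m/n]*n (suc k) p ⟩
    suc k % p ℕ.+ suc k / p ℕ.* p ≡⟨ cong₂ ℕ._+_ (does≡true⇒ (suc k % p ℕ.≟ 0) p∣k+1) (cong (ℕ._* p) quotient) ⟩
    0                           ∎))
    where open ≡-Reasoning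

  ∙-suc-gap : ∀ j k F G → (∀ i → i < j → F (suc i) ≡ + 0) →
              (F ∙ G) (suc (j ℕ.+ k)) ≡ F 0 * G (suc (j ℕ.+ k)) + (F ∘ (suc j ℕ.+_) ∙ G) k
  ∙-suc-gap zero    k F G z = ∙-suc F G k
  ∙-suc-gap (suc j) k F G z =
    trans (∙-suc F G (suc (j ℕ.+ k))) (cong (_+_ (F 0 * G (suc (suc j ℕ.+ k))))
      (trans (∙-suc-gap j k (shift F) G (λ i i<j → z (suc i) (s≤s i<j)))
        (trans (cong (λ t → t * G (suc (j ℕ.+ k)) + (F ∘ (suc (suc j) ℕ.+_) ∙ G) k) (z 0 (s≤s z≤n))) (ℤP.+-identityˡ _))))

  dilate-∙-≤q : ∀ F G k → k ≤ q → dilate (F ∙ G) k ≡ (dilate F ∙ dilate G) k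
  dilate-∙-≤q F G zero    _   = trans (∙-head F G) (sym (∙-head (dilate F) (dilate G)))
  dilate-∙-≤q F G (suc k) k<q = sym (trans (∙-suc (dilate F) (dilate G) k)
    (trans (cong₂ _+_ (trans (cong (F 0 *_) (dilate-suc-< G k k<q)) (ℤP.*-zeroʳ (F 0)))
                      (∙-zeroˡ-upTo (shift (dilate F)) (dilate G) k (λ i i≤k → dilate-suc-< F i (ℕP.≤-trans (s≤s i≤k) k<q))))
           (sym (dilate-suc-< (F ∙ G) k k<q))))

  dilate-∙-bounded : ∀ n k → k < n → ∀ F G → dilate (F ∙ G) k ≡ (dilate F ∙ dilate G) k
  dilate-∙-bounded (suc n) k (s≤s k≤n) F G with k ℕP.≤? q
  ... | yes k≤q = dilate-∙-≤q F G k k≤q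
  ... | no  k≰q = subst (λ t → dilate (F ∙ G) t ≡ (dilate F ∙ dilate G) t) (ℕP.m+[n∸m]≡n (ℕP.≰⇒> k≰q)) (beyond-p (k ∸ p) j<n)
    where
    j<n : k ∸ p < n
    j<n = ℕP.<-≤-trans (ℕP.∸-monoʳ-< {m = k} {n = p} {o = 0} (s≤s z≤n) (ℕP.≰⇒> k≰q)) k≤n
    beyond-p : ∀ j → j < n → dilate (F ∙ G) (p ℕ.+ j) ≡ (dilate F ∙ dilate G) (p ℕ.+ j)
    beyond-p j j<n = begin
      dilate (F ∙ G) (p ℕ.+ j)                                  ≡⟨ dilate-p+ (F ∙ G) j ⟩
      dilate (shift (F ∙ G)) j                                  ≡⟨ dilate-cong (shift-∙ F G) j ⟩
      dilate (F 0 · shift G ⊕ shift F ∙ G) j                    ≡⟨ dilate-⊕ (F 0 · shift G) (shift F ∙ G) j ⟩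
      dilate (F 0 · shift G) j + dilate (shift F ∙ G) j
        ≡⟨ cong₂ _+_ (trans (dilate-· (F 0) (shift G) j) (cong (F 0 *_) (sym (dilate-p+ G j))))
                     (dilate-∙-bounded n j j<n (shift F) G) ⟩
      F 0 * dilate G (p ℕ.+ j) + (dilate (shift F) ∙ dilate G) j
        ≡⟨ cong (_+_ (F 0 * dilate G (p ℕ.+ j))) (∙-congˡ (dilate G) (λ i → sym (dilate-p+ F i)) j) ⟩
      dilate F 0 * dilate G (p ℕ.+ j) + (dilate F ∘ (p ℕ.+_) ∙ dilate G) j
        ≡⟨ ∙-suc-gap q j (dilate F) (dilate G) (dilate-suc-< F) ⟨
      (dilate F ∙ dilate G) (p ℕ.+ j)                           ∎
      where open ≡-Reasoning

  dilate-∙ : ∀ F G → dilate (F ∙ G) ≈ dilate F ∙ dilate G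
  dilate-∙ F G k = dilate-∙-bounded (suc k) k ℕP.≤-refl F G

  dilate-invS : ∀ F → IsUnit F → dilate (invS F) ≈ invS (dilate F)
  dilate-invS F u = invS-unique (dilate F) (dilate (invS F)) u
    (≈-trans (≈-sym (dilate-∙ (invS F) F)) (≈-trans (dilate-cong (invS-inverseˡ F u)) dilate-oneS))

  xpowMinus1-p* : ∀ m t → xpowMinus1 (suc m) t ≡ xpowMinus1 (p ℕ.* suc m) (p ℕ.* t)
  xpowMinus1-p* m zero rewrite ℕP.*-zeroʳ p = refl
  xpowMinus1-p* m (suc t) with does (suc t ℕ.≟ suc m) | does (p ℕ.* suc t ℕ.≟ p ℕ.* suc m)
     | does-⇔ (mk⇔ (cong (p ℕ.*_)) (ℕP.*-cancelˡ-≡ (suc t) (suc m) p)) (suc t ℕ.≟ suc m) (p ℕ.* suc t ℕ.≟ p ℕ.* suc m)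
  ... | true  | true  | _ = refl
  ... | false | false | _ = refl
  ... | true  | false | ()
  ... | false | true  | ()

  dilate-xpowMinus1 : ∀ m → dilate (xpowMinus1 (suc m)) ≈ xpowMinus1 (p ℕ.* suc m)
  dilate-xpowMinus1 m zero = refl
  dilate-xpowMinus1 m (suc k) with does (suc k % p ℕ.≟ 0) in p∣k+1
  ... | true = trans (xpowMinus1-p* m (suc k / p))
                 (cong (xpowMinus1 (p ℕ.* suc m)) (m*[n/m]≡n (m%n≡0⇒n∣m (suc k) p (does≡true⇒ (suc k % p ℕ.≟ 0) p∣k+1))))
  ... | false with does (suc k ℕ.≟ p ℕ.* suc m) in k+1≡pm
  ...   | false = refl
  ...   | true  = ⊥-elim (true≢false (trans (sym (dec-true (suc k % p ℕ.≟ 0) p∣k+1′)) p∣k+1))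
    where
    p∣k+1′ : suc k % p ≡ 0
    p∣k+1′ = trans (cong (_% p) (does≡true⇒ (suc k ℕ.≟ p ℕ.* suc m) k+1≡pm))
                   (trans (cong (_% p) (ℕP.*-comm p (suc m))) (m*n%n≡0 (suc m) p))
    true≢false : true ≢ false
    true≢false ()

  dilate-prodWhen : ∀ B F n → dilate (prodWhen B F n) ≈ prodWhen B (dilate ∘ F) n
  dilate-prodWhen B F zero = dilate-oneS
  dilate-prodWhen B F (suc n) with B n
  ... | true  = ≈-trans (dilate-∙ (F n) (prodWhen B F n)) (∙-congʳ (dilate (F n)) (dilate-prodWhen B F n))
  ... | false = dilate-prodWhen B F n

module Cyclotomic where
  open PowerSeries
  open Inverse
  open Products
  open import Data.Nat.Divisibility using (_∣?_; ∣-refl)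
  open import Data.Nat.Induction using (<-rec)
  open import Relation.Nullary.Decidable using (dec-true)

  -- The index j stands for the divisor j + 1.
  Φ₊ : ℕ → Series
  Φ₊ j = Φ (suc j)

  divides? : ℕ → ℕ → Bool
  divides? N j = does (suc j ∣? N)

  lookup-ΦVec : ∀ n (j : Fin n) → lookup (ΦVec n) j ≡ Φ₊ (toℕ j)
  lookup-ΦVec (suc n) j with toℕ j ℕP.<? n
  ... | yes j<n = trans (lookup-∷ʳ-< (ΦVec n) _ j j<n) (trans (lookup-ΦVec n (fromℕ< j<n)) (cong Φ₊ (FinP.toℕ-fromℕ< j<n)))
  ... | no  j≮n = trans (lookup-∷ʳ-last (ΦVec n) _ j (toℕ≮⇒≡ j j≮n))
                    (sym (trans (cong Φ₊ (toℕ≮⇒≡ j j≮n)) (VecP.last-∷ʳ _ (ΦVec n))))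

  properDivisorProduct : ℕ → Series
  properDivisorProduct n = Vec.foldr _ (λ j acc → if does (suc (toℕ j) ∣? suc n) then lookup (ΦVec n) j ∙ acc else acc)
                                     oneS (Vec.allFin n)

  Φ-suc : ∀ n → Φ (suc n) ≡ xpowMinus1 (suc n) ∙ invS (properDivisorProduct n)
  Φ-suc n = VecP.last-∷ʳ _ (ΦVec n)

  properDivisorProduct≈prodWhen : ∀ n → properDivisorProduct n ≈ prodWhen (divides? (suc n)) Φ₊ n
  properDivisorProduct≈prodWhen n =
    ≈-trans (foldr-tabulate≈prodFrom n 0 (λ j → j) _ (divides? (suc n)) Φ₊ step≡ (λ _ → refl))
            (prodFrom≈prodWhen (divides? (suc n)) Φ₊ n)
    where
    step≡ : ∀ j acc → (if does (suc (toℕ j) ∣? suc n) then lookup (ΦVec n) j ∙ acc else acc)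
                      ≡ mulWhen (divides? (suc n) (toℕ j)) (Φ₊ (toℕ j)) acc
    step≡ j acc rewrite lookup-ΦVec n j = refl

  IsUnit-Φ₊ : ∀ n → IsUnit (Φ₊ n)
  IsUnit-Φ₊ = <-rec (IsUnit ∘ Φ₊) λ n rec →
    subst IsUnit (sym (Φ-suc n))
      (IsUnit-∙ (xpowMinus1 (suc n)) (invS (properDivisorProduct n)) refl
        (IsUnit-≈ (≈-sym (properDivisorProduct≈prodWhen n)) (IsUnit-prodWhen (divides? (suc n)) Φ₊ n (λ _ → rec))))

  IsUnit-prodWhen-Φ₊ : ∀ B n → IsUnit (prodWhen B Φ₊ n)
  IsUnit-prodWhen-Φ₊ B n = IsUnit-prodWhen B Φ₊ n (λ i _ → IsUnit-Φ₊ i)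

  divisorProduct : ℕ → Series
  divisorProduct N = prodWhen (divides? N) Φ₊ N

  divisorProduct≈xpowMinus1 : ∀ n → divisorProduct (suc n) ≈ xpowMinus1 (suc n)
  divisorProduct≈xpowMinus1 n rewrite dec-true (suc n ∣? suc n) ∣-refl = begin
    Φ (suc n) ∙ D                    ≡⟨ cong (_∙ D) (Φ-suc n) ⟩
    X ∙ invS (properDivisorProduct n) ∙ D
      ≈⟨ ∙-congˡ D (∙-congʳ X (invS-cong unitD (properDivisorProduct≈prodWhen n))) ⟩
    X ∙ invS D ∙ D                   ≈⟨ ∙-assoc X (invS D) D ⟩
    X ∙ (invS D ∙ D)                 ≈⟨ ∙-congʳ X (invS-inverseˡ D unitD) ⟩
    X ∙ oneS                         ≈⟨ ∙-identityʳ X ⟩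
    X                                ∎
    where
    open import Relation.Binary.Reasoning.Setoid ≈-setoid
    X = xpowMinus1 (suc n)
    D = prodWhen (divides? (suc n)) Φ₊ n
    unitD : IsUnit D
    unitD = IsUnit-prodWhen-Φ₊ (divides? (suc n)) n

  dilate-divisorProduct : ∀ q n → Dilation.dilate q (divisorProduct (suc n)) ≈ divisorProduct (suc q ℕ.* suc n)
  dilate-divisorProduct q n = begin
    dilate (divisorProduct (suc n))    ≈⟨ dilate-cong (divisorProduct≈xpowMinus1 n) ⟩
    dilate (xpowMinus1 (suc n))        ≈⟨ dilate-xpowMinus1 n ⟩
    xpowMinus1 (suc q ℕ.* suc n)       ≈⟨ divisorProduct≈xpowMinus1 (n ℕ.+ q ℕ.* suc n) ⟨
    divisorProduct (suc q ℕ.* suc n)   ∎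
    where
    open Dilation q
    open import Relation.Binary.Reasoning.Setoid ≈-setoid

module PrimeDilation (r : ℕ) (p-prime : Prime (suc (suc r))) where
  open PowerSeries
  open Inverse
  open Products
  open Cyclotomic
  open Dilation (suc r)
  open import Data.Nat.Divisibility using (_∣_; _∣?_; divides; ∣-refl; ∣⇒≤; ∣m+n∣m⇒∣n; n∣m*n; ∣n⇒∣m*n; *-cancelˡ-∣; *-monoʳ-∣)
  open import Data.Nat.Primality using (euclidsLemma; prime⇒irreducible)
  open import Data.Nat.Coprimality using (Coprime; coprime-divisor)
  open import Data.Nat.Induction using (<-rec)
  open import Data.Nat.Tactic.RingSolver using (solve-∀)
  open import Data.Sum using (inj₁; inj₂)
  open import Function.Bundles using (mk⇔)
  open import Relation.Nullary using (_×-dec_; ¬?)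
  open import Relation.Nullary.Decidable using (does-⇔; dec-true; dec-false)

  q : ℕ
  q = suc r

  ¬p∣offGrid : ∀ e i → i < q → ¬ p ∣ suc (e ℕ.* p ℕ.+ i)
  ¬p∣offGrid e i i<q p∣ = ℕP.<-irrefl refl (ℕP.<-≤-trans (s≤s i<q)
    (∣⇒≤ (∣m+n∣m⇒∣n (subst (p ∣_) (sym (ℕP.+-suc (e ℕ.* p) i)) p∣) (n∣m*n e))))

  onGrid : ∀ e → suc (e ℕ.* p ℕ.+ q) ≡ p ℕ.* suc e
  onGrid e = ring e r
    where
    ring : ∀ e r → suc (e ℕ.* suc (suc r) ℕ.+ suc r) ≡ suc (suc r) ℕ.* suc e
    ring = solve-∀

  ∣p*∧¬p∣⇒∣ : ∀ {d N} → d ∣ p ℕ.* N → ¬ p ∣ d → d ∣ N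
  ∣p*∧¬p∣⇒∣ {d} d∣pN p∤d = coprime-divisor coprime d∣pN
    where
    coprime : Coprime d p
    coprime {i} (i∣d , i∣p) with prime⇒irreducible p-prime i∣p
    ... | inj₁ i≡1    = i≡1
    ... | inj₂ refl   = ⊥-elim (p∤d i∣d)

  ¬p*∣⇒p∣ : ∀ {e N} → p ∣ N → e ∣ N → ¬ (p ℕ.* e ∣ N) → p ∣ e
  ¬p*∣⇒p∣ {e} p∣N (divides t N≡te) pe∤N with p ∣? e
  ... | yes p∣e = p∣e
  ... | no  p∤e with euclidsLemma t e p-prime (subst (p ∣_) N≡te p∣N)
  ...   | inj₂ p∣e = ⊥-elim (p∤e p∣e)
  ...   | inj₁ (divides s t≡sp) = ⊥-elim (pe∤N (divides s (trans N≡te (trans (cong (ℕ._* e) t≡sp) (ℕP.*-assoc s p e)))))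

  -- Divisors j + 1 of N that carry the full power of p dividing N.
  saturated? : ℕ → ℕ → Bool
  saturated? N j = divides? N j ∧ not (does (p ℕ.* suc j ∣? N))

  divides?-p*-∧ : ∀ N j → divides? (p ℕ.* N) j ∧ divides? N j ≡ divides? N j
  divides?-p*-∧ N j = does-⇔ (mk⇔ proj₂ (λ d∣N → ∣n⇒∣m*n p d∣N , d∣N)) (suc j ∣? p ℕ.* N ×-dec suc j ∣? N) (suc j ∣? N)

  divides?-beyond : ∀ n i → suc n ≤ i → divides? (suc n) i ≡ false
  divides?-beyond n i n<i = dec-false (suc i ∣? suc n) (λ d → ℕP.≤⇒≯ (∣⇒≤ d) (s≤s n<i))

  newDivisor-offGrid : ∀ N e i → i < q → divides? (p ℕ.* N) (e ℕ.* p ℕ.+ i) ∧ not (divides? N (e ℕ.* p ℕ.+ i)) ≡ false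
  newDivisor-offGrid N e i i<q = dec-false (suc (e ℕ.* p ℕ.+ i) ∣? p ℕ.* N ×-dec ¬? (suc (e ℕ.* p ℕ.+ i) ∣? N))
    (λ (d∣pN , d∤N) → d∤N (∣p*∧¬p∣⇒∣ d∣pN (¬p∣offGrid e i i<q)))

  newDivisor-onGrid : ∀ N e → divides? (p ℕ.* N) (e ℕ.* p ℕ.+ q) ∧ not (divides? N (e ℕ.* p ℕ.+ q)) ≡ saturated? N e
  newDivisor-onGrid N e = does-⇔
    (mk⇔ (λ (d∣pN , d∤N) → *-cancelˡ-∣ p (subst (_∣ p ℕ.* N) (onGrid e) d∣pN) , d∤N ∘ subst (_∣ N) (sym (onGrid e)))
         (λ (e∣N , pe∤N) → subst (_∣ p ℕ.* N) (sym (onGrid e)) (*-monoʳ-∣ p e∣N) , pe∤N ∘ subst (_∣ N) (onGrid e)))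
    (suc (e ℕ.* p ℕ.+ q) ∣? p ℕ.* N ×-dec ¬? (suc (e ℕ.* p ℕ.+ q) ∣? N)) (suc e ∣? N ×-dec ¬? (p ℕ.* suc e ∣? N))

  divides?-∧-p*∣ : ∀ M j → divides? (p ℕ.* M) j ∧ does (p ℕ.* suc j ∣? p ℕ.* M) ≡ divides? M j
  divides?-∧-p*∣ M j = does-⇔ (mk⇔ (*-cancelˡ-∣ p ∘ proj₂) (λ d∣M → ∣n⇒∣m*n p d∣M , *-monoʳ-∣ p d∣M))
    (suc j ∣? p ℕ.* M ×-dec p ℕ.* suc j ∣? p ℕ.* M) (suc j ∣? M)

  saturated?-self : ∀ n → saturated? (suc n) n ≡ true
  saturated?-self n = dec-true (suc n ∣? suc n ×-dec ¬? (p ℕ.* suc n ∣? suc n))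
    (∣-refl , λ d → ℕP.≤⇒≯ (∣⇒≤ d) (ℕP.m<m+n (suc n) (s≤s z≤n)))

  divisorProduct-p* : ∀ n → divisorProduct (p ℕ.* suc n) ≈ divisorProduct (suc n) ∙ prodWhen (saturated? (suc n)) (Φ ∘ (p ℕ.*_) ∘ suc) (suc n)
  divisorProduct-p* n = ≈-trans (prodWhen-split (divides? T) (divides? N) Φ₊ T) (∙-cong (≡⇒≈ oldDivisors) newDivisors)
    where
    N T : ℕ
    N = suc n
    T = p ℕ.* N
    oldDivisors : prodWhen (λ j → divides? T j ∧ divides? N j) Φ₊ T ≡ divisorProduct N
    oldDivisors = begin
      prodWhen (λ j → divides? T j ∧ divides? N j) Φ₊ T   ≡⟨ prodWhen-cong Φ₊ T (λ j _ → divides?-p*-∧ N j) ⟩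
      prodWhen (divides? N) Φ₊ T                           ≡⟨ cong (prodWhen (divides? N) Φ₊) (ℕP.m∸n+n≡m (ℕP.m≤n*m N p)) ⟨
      prodWhen (divides? N) Φ₊ (T ∸ N ℕ.+ N)               ≡⟨ prodWhen-+ (divides? N) Φ₊ N (divides?-beyond n) (T ∸ N) ⟩
      divisorProduct N                                     ∎
      where open ≡-Reasoning
    new? : ℕ → Bool
    new? j = divides? T j ∧ not (divides? N j)
    newDivisors : prodWhen new? Φ₊ T ≈ prodWhen (saturated? N) (Φ ∘ (p ℕ.*_) ∘ suc) N
    newDivisors = ≈-trans (≡⇒≈ (begin
      prodWhen new? Φ₊ T                                           ≡⟨ cong (prodWhen new? Φ₊) (ℕP.*-comm p N) ⟩
      prodWhen new? Φ₊ (N ℕ.* p)                                   ≡⟨ prodWhen-sparse q new? Φ₊ N (newDivisor-offGrid N) ⟩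
      prodWhen (λ e → new? (e ℕ.* p ℕ.+ q)) (λ e → Φ₊ (e ℕ.* p ℕ.+ q)) N
        ≡⟨ prodWhen-cong (λ e → Φ₊ (e ℕ.* p ℕ.+ q)) N (λ e _ → newDivisor-onGrid N e) ⟩
      prodWhen (saturated? N) (λ e → Φ₊ (e ℕ.* p ℕ.+ q)) N          ∎))
      (prodWhen-congF (saturated? N) N (λ e _ _ k → cong (λ t → Φ t k) (onGrid e)))
      where open ≡-Reasoning

  divisorProduct-split : ∀ m n → suc n ≡ p ℕ.* suc m → divisorProduct (suc n) ≈ divisorProduct (suc m) ∙ prodWhen (saturated? (suc n)) Φ₊ (suc n)
  divisorProduct-split m n N≡pM = ≈-trans (prodWhen-split (divides? N) (λ j → does (p ℕ.* suc j ∣? N)) Φ₊ N)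
                                          (∙-congˡ (prodWhen (saturated? N) Φ₊ N) (≡⇒≈ divisorsOfM))
    where
    N M : ℕ
    N = suc n
    M = suc m
    M≤N : M ≤ N
    M≤N = subst (M ≤_) (sym N≡pM) (ℕP.m≤n*m M p)
    divisorsOfM : prodWhen (λ j → divides? N j ∧ does (p ℕ.* suc j ∣? N)) Φ₊ N ≡ divisorProduct M
    divisorsOfM = begin
      prodWhen (λ j → divides? N j ∧ does (p ℕ.* suc j ∣? N)) Φ₊ N
        ≡⟨ prodWhen-cong Φ₊ N (λ j _ → subst (λ t → divides? t j ∧ does (p ℕ.* suc j ∣? t) ≡ divides? M j) (sym N≡pM) (divides?-∧-p*∣ M j)) ⟩
      prodWhen (divides? M) Φ₊ N                 ≡⟨ cong (prodWhen (divides? M) Φ₊) (ℕP.m∸n+n≡m M≤N) ⟨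
      prodWhen (divides? M) Φ₊ (N ∸ M ℕ.+ M)     ≡⟨ prodWhen-+ (divides? M) Φ₊ M (divides?-beyond m) (N ∸ M) ⟩
      divisorProduct M                           ∎
      where open ≡-Reasoning

  p∣saturated : ∀ n e → p ∣ suc n → saturated? (suc n) e ≡ true → p ∣ suc e
  p∣saturated n e p∣N sat with does≡true⇒ (suc e ∣? suc n ×-dec ¬? (p ℕ.* suc e ∣? suc n)) sat
  ... | e∣N , pe∤N = ¬p*∣⇒p∣ p∣N e∣N pe∤N

  saturatedProduct-suc : ∀ n F → prodWhen (saturated? (suc n)) F (suc n) ≡ F n ∙ prodWhen (saturated? (suc n)) F n
  saturatedProduct-suc n F = prodWhen-suc-true (saturated? (suc n)) F n (saturated?-self n)

  Φ-p* : ∀ n → p ∣ suc n → Φ (p ℕ.* suc n) ≈ dilate (Φ (suc n))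
  Φ-p* = <-rec _ step
    where
    step : ∀ n → (∀ {j} → j < n → p ∣ suc j → Φ (p ℕ.* suc j) ≈ dilate (Φ (suc j))) →
           p ∣ suc n → Φ (p ℕ.* suc n) ≈ dilate (Φ (suc n))
    step n rec (divides zero    N≡0)  = ⊥-elim (ℕP.1+n≢0 N≡0)
    step n rec (divides (suc m) N≡Mp) =
      ∙-cancelʳ (Φ T) (dilate W) (dilate (Φ N)) (IsUnit-prodWhen-Φ₊ (saturated? N) n)
        (∙-cancelˡ (divisorProduct N) (Φ T ∙ dilate W) (dilate (Φ N) ∙ dilate W) (IsUnit-prodWhen-Φ₊ (divides? N) N) key)
      where
      N M T : ℕ
      N = suc n
      M = suc m
      T = p ℕ.* N
      N≡pM : N ≡ p ℕ.* M
      N≡pM = trans N≡Mp (ℕP.*-comm M p)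
      W Wₚ : Series
      W  = prodWhen (saturated? N) Φ₊ n
      Wₚ = prodWhen (saturated? N) (Φ ∘ (p ℕ.*_) ∘ suc) n
      Wₚ≈dilateW : Wₚ ≈ dilate W
      Wₚ≈dilateW = ≈-trans (prodWhen-congF (saturated? N) n (λ e e<n sat → rec e<n (p∣saturated n e (divides (suc m) N≡Mp) sat)))
                           (≈-sym (dilate-prodWhen (saturated? N) Φ₊ n))
      key : divisorProduct N ∙ (Φ T ∙ dilate W) ≈ divisorProduct N ∙ (dilate (Φ N) ∙ dilate W)
      key = begin
        divisorProduct N ∙ (Φ T ∙ dilate W)                         ≈⟨ ∙-congʳ (divisorProduct N) (∙-congʳ (Φ T) Wₚ≈dilateW) ⟨
        divisorProduct N ∙ (Φ T ∙ Wₚ)                                ≡⟨ cong (divisorProduct N ∙_) (saturatedProduct-suc n (Φ ∘ (p ℕ.*_) ∘ suc)) ⟨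
        divisorProduct N ∙ prodWhen (saturated? N) (Φ ∘ (p ℕ.*_) ∘ suc) N ≈⟨ divisorProduct-p* n ⟨
        divisorProduct T                                             ≈⟨ dilate-divisorProduct q n ⟨
        dilate (divisorProduct N)                                    ≈⟨ dilate-cong (divisorProduct-split m n N≡pM) ⟩
        dilate (divisorProduct M ∙ prodWhen (saturated? N) Φ₊ N)     ≈⟨ dilate-∙ (divisorProduct M) (prodWhen (saturated? N) Φ₊ N) ⟩
        dilate (divisorProduct M) ∙ dilate (prodWhen (saturated? N) Φ₊ N)
          ≈⟨ ∙-cong (≈-trans (dilate-divisorProduct q m) (≡⇒≈ (cong divisorProduct (sym N≡pM))))
                    (dilate-cong (≡⇒≈ (saturatedProduct-suc n Φ₊))) ⟩
        divisorProduct N ∙ dilate (Φ N ∙ W)                          ≈⟨ ∙-congʳ (divisorProduct N) (dilate-∙ (Φ N) W) ⟩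
        divisorProduct N ∙ (dilate (Φ N) ∙ dilate W)                 ∎
        where open import Relation.Binary.Reasoning.Setoid ≈-setoid

  invS-Φ-p* : ∀ n → p ∣ suc n → invS (Φ (p ℕ.* suc n)) ≈ dilate (invS (Φ (suc n)))
  invS-Φ-p* n p∣N = ≈-trans (invS-cong (IsUnit-Φ₊ n) (Φ-p* n p∣N)) (≈-sym (dilate-invS (Φ (suc n)) (IsUnit-Φ₊ n)))

  module Tower (G : Series → Series) (G-Φ-p* : ∀ n → p ∣ suc n → G (Φ (p ℕ.* suc n)) ≈ dilate (G (Φ (suc n)))) where
    open import Data.Nat using (_^_; _≥_)
    open import Data.Nat.Divisibility using (m∣m*n)
    open import Data.Product using (∃-syntax)
    open import Function.Bundles using (_⇔_)

    G-Φ-p*-pos : ∀ {N} → 0 < N → p ∣ N → G (Φ (p ℕ.* N)) ≈ dilate (G (Φ N))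
    G-Φ-p*-pos (s≤s z≤n) = G-Φ-p* _

    tower : ∀ l {N} → 0 < N → ∀ k → G (Φ (p ^ suc l ℕ.* N)) (p ^ l ℕ.* k) ≡ G (Φ (p ℕ.* N)) k
    tower zero    {N} _   k = cong₂ (λ t u → G (Φ t) u) (cong (ℕ._* N) (ℕP.*-identityʳ p)) (ℕP.*-identityˡ k)
    tower (suc l) {N} 0<N k = begin
      G (Φ (p ^ suc (suc l) ℕ.* N)) (p ^ suc l ℕ.* k)   ≡⟨ cong₂ (λ t u → G (Φ t) u) (ℕP.*-assoc p (p ^ suc l) N) (ℕP.*-assoc p (p ^ l) k) ⟩
      G (Φ (p ℕ.* L)) (p ℕ.* (p ^ l ℕ.* k))             ≡⟨ G-Φ-p*-pos 0<L p∣L (p ℕ.* (p ^ l ℕ.* k)) ⟩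
      dilate (G (Φ L)) (p ℕ.* (p ^ l ℕ.* k))            ≡⟨ dilate-p* (G (Φ L)) (p ^ l ℕ.* k) ⟩
      G (Φ L) (p ^ l ℕ.* k)                              ≡⟨ tower l 0<N k ⟩
      G (Φ (p ℕ.* N)) k                                  ∎
      where
      open ≡-Reasoning
      L : ℕ
      L = p ^ suc l ℕ.* N
      0<L : 0 < L
      0<L = ℕP.*-mono-≤ (ℕP.m^n>0 p (suc l)) 0<N
      p∣L : p ∣ L
      p∣L = subst (p ∣_) (sym (ℕP.*-assoc p (p ^ l) N)) (m∣m*n (p ^ l ℕ.* N))

    -- Definitionally, S = Coefficients (λ f → f) and R = Coefficients invS.
    Coefficients : ℕ → ℤ → Set
    Coefficients M z = ∃[ n ] ∃[ k ] (n ≥ 1 × G (Φ (M ℕ.* n)) k ≡ z)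

    Coefficients-p^⇔ : ∀ j m → m ≥ 1 → ∀ z → Coefficients (p ^ suc j ℕ.* m) z ⇔ Coefficients (p ℕ.* m) z
    Coefficients-p^⇔ j m m≥1 z = mk⇔ lower raise
      where
      p^j*-≥1 : ∀ n → n ≥ 1 → p ^ j ℕ.* n ≥ 1
      p^j*-≥1 n n≥1 = ℕP.*-mono-≤ (ℕP.m^n>0 p j) n≥1
      lower : Coefficients (p ^ suc j ℕ.* m) z → Coefficients (p ℕ.* m) z
      lower (n , k , n≥1 , eq) = p ^ j ℕ.* n , k , p^j*-≥1 n n≥1 , trans (cong (λ t → G (Φ t) k) (regroup p (p ^ j) m n)) eq
        where
        regroup : ∀ a x m n → a ℕ.* m ℕ.* (x ℕ.* n) ≡ a ℕ.* x ℕ.* m ℕ.* n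
        regroup = solve-∀
      raise : Coefficients (p ℕ.* m) z → Coefficients (p ^ suc j ℕ.* m) z
      raise (n , k , n≥1 , eq) = n , p ^ j ℕ.* k , n≥1 , (begin
        G (Φ (p ^ suc j ℕ.* m ℕ.* n)) (p ^ j ℕ.* k)  ≡⟨ cong (λ t → G (Φ t) (p ^ j ℕ.* k)) (ℕP.*-assoc (p ^ suc j) m n) ⟩
        G (Φ (p ^ suc j ℕ.* (m ℕ.* n))) (p ^ j ℕ.* k) ≡⟨ tower j (ℕP.*-mono-≤ m≥1 n≥1) k ⟩
        G (Φ (p ℕ.* (m ℕ.* n))) k                    ≡⟨ cong (λ t → G (Φ t) k) (ℕP.*-assoc p m n) ⟨
        G (Φ (p ℕ.* m ℕ.* n)) k                      ≡⟨ eq ⟩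
        z                                            ∎)
        where open ≡-Reasoning

open import Data.Nat using (_*_; _^_; _≥_)
open import Function.Bundles using (_⇔_)

lemma2 : (p l m : ℕ) → Prime p → l ≥ 1 → m ≥ 1 →
    ((z : ℤ) → S (p ^ l * m) z ⇔ S (p * m) z) × ((z : ℤ) → R (p ^ l * m) z ⇔ R (p * m) z)
lemma2 zero          _       _ p-prime _ _ with () ← ℕ.nonTrivial⇒n>1 0 {{prime⇒nonTrivial p-prime}}
lemma2 (suc zero)    _       _ p-prime _ _ with s≤s () ← ℕ.nonTrivial⇒n>1 1 {{prime⇒nonTrivial p-prime}}
lemma2 (suc (suc r)) (suc j) m p-prime _ m≥1 =
  (Tower.Coefficients-p^⇔ (λ f → f) Φ-p* j m m≥1) , (Tower.Coefficients-p^⇔ invS invS-Φ-p* j m m≥1)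
  where open PrimeDilation r p-prime
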